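{- Let $n\ge k\ge 1$ and let $T$ be a nonempty sequence over the cyclic semigroup $C_{k;n}$. Then $T$ is idempotent-sum free (resp. idempotent-sum) if and only if $\Psi(T)$ is a zero-sum free (resp. zero-sum) sequence over $\mathbb{Z}/n\mathbb{Z}$. Moreover, $$N(T;\mathbf{e})=\begin{cases}N(\Psi(T))-1 & \text{if } k>1,\\ N(\Psi(T)) & \text{if } k=1.\end{cases}$$
   Context: $C_{k;n}=\langle s\rangle$ is the cyclic semigroup generated by $s$ with index $k$ and period $n$; its elements are $s,\dots,(k+n-1)s$ and it has a unique idempotent $\mathbf{e}$ (for $k=1$ it is the cyclic group of order $n$ with identity $\mathbf{e}$). For $a\in C_{k;n}$, ${\rm Ind}(a)$ is the least positive $t$ with $ts=a$. For a sequence $T$ over $C_{k;n}$, $\Psi(T)$ is the sequence $({\rm Ind}(a)+n\mathbb{Z})_{a\mid T}$ over $\mathbb{Z}/n\mathbb{Z}$. A sequence is idempotent-sum if the sum of its terms is an idempotent, and idempotent-sum free if no nonempty subsequence is idempotent-sum; zero-sum / zero-sum free are defined analogously with $0$. Subsequences are indexed by subsets of positions and counted as distinct if the index sets differ. $N(T;\mathbf{e})$ is the number of subsequences of $T$ with sum $\mathbf{e}$, where the empty subsequence is counted only when $k=1$ (it has the identity as sum); $N(\Psi(T))$ is the number of subsequences of $\Psi(T)$, including the empty one, with sum $0$. -}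

module Defs where

open import Data.Nat using (ℕ; zero; suc; _+_; _∸_; _≤_; _<_; _<?_; _≟_)
open import Data.Nat.DivMod using (_%_)
open import Data.Bool using (Bool; true; false; if_then_else_)
open import Data.Vec using (Vec; []; _∷_)
open import Data.List using (List; []; _∷_; length; filter; map; _++_)
open import Data.Nat.ListAction using (sum)
open import Data.Maybe using (Maybe; just; nothing)
open import Data.Product using (Σ; _×_; _,_)
open import Data.Sum using (_⊎_)
open import Relation.Binary.PropositionalEquality using (_≡_)
open import Relation.Nullary using (Dec; ¬_; yes; no)
open import Relation.Nullary.Decidable using (⌊_⌋; _⊎-dec_; _×-dec_)
open import Data.Fin.Subset using (Subset)

-- The cyclic semigroup C_{k;n} = ⟨s⟩ with index k and period n.
-- An element  t·s  (1 ≤ t ≤ k+n-1) is represented by the natural number t,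
-- i.e. by its index Ind(t·s) = t.

IsElem : ℕ → ℕ → ℕ → Set
IsElem k n a = 1 ≤ a × a < k + n

-- red k n t : the index of t·s for an arbitrary positive t
-- (t·s = t·s if t < k + n, otherwise reduce by the period n into [k, k+n-1]).
red : ℕ → ℕ → ℕ → ℕ
red k zero    t = t            -- degenerate, never used (n ≥ 1)
red k (suc p) t with t <? k + suc p
... | yes _ = t
... | no  _ = k + ((t ∸ k) % suc p)

-- semigroup operation:  (a·s) + (b·s) = (a+b)·s
_⊕[_,_]_ : ℕ → ℕ → ℕ → ℕ → ℕ
a ⊕[ k , n ] b = red k n (a + b)

IsIdem : ℕ → ℕ → ℕ → Set
IsIdem k n e = (e ⊕[ k , n ] e) ≡ e

σ : ℕ → ℕ → List ℕ → Maybe ℕ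
σ k n []       = nothing
σ k n (a ∷ as) with σ k n as
... | nothing = just a
... | just b  = just (a ⊕[ k , n ] b)

select : ∀ {A : Set} {m} → Subset m → Vec A m → List A
select []           []       = []
select (true  ∷ S) (a ∷ as) = a ∷ select S as
select (false ∷ S) (a ∷ as) = select S as

allSubsets : ∀ m → List (Subset m)
allSubsets zero    = [] ∷ []
allSubsets (suc m) = map (true ∷_) (allSubsets m) ++ map (false ∷_) (allSubsets m)

IdemSumList : ℕ → ℕ → List ℕ → Set
IdemSumList k n as = Σ ℕ λ e → σ k n as ≡ just e × IsIdem k n e

idemSumList? : ∀ k n as → Dec (IdemSumList k n as)
idemSumList? k n as with σ k n as
... | nothing = no λ { (e , () , _) }
... | just e with (e ⊕[ k , n ] e) ≟ e
...   | yes p = yes (e , _≡_.refl , p)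
...   | no ¬p = no λ { (.e , _≡_.refl , p) → ¬p p }

IdemSum : ∀ k n {m} → Vec ℕ m → Set
IdemSum k n T = IdemSumList k n (Data.Vec.toList T)

IdemSumFree : ∀ k n {m} → Vec ℕ m → Set
IdemSumFree k n {m} T = (S : Subset m) → ¬ IdemSumList k n (select S T)

-- N(T; e): number of subsequences with sum e, where the empty subsequence
-- is counted only for k = 1 (its sum is the identity e).
NIdem : ∀ k n {m} → Vec ℕ m → ℕ
NIdem k n {m} T =
  length (filter (λ S → (idemSumList? k n (select S T))
                         ⊎-dec ((k ≟ 1) ×-dec (length (select S T) ≟ 0)))
                 (allSubsets m))

-- Z/nZ: a residue class is represented by a natural number, and a sequence
-- over Z/nZ is zero-sum iff the sum of representatives is ≡ 0 mod n.

sumMod : ℕ → List ℕ → ℕ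
sumMod zero    xs = sum xs
sumMod (suc p) xs = sum xs % suc p

-- Ψ(T) : (Ind(a) + nZ)_{a | T}, with representatives reduced into [0, n-1]
Ψ : ∀ (n : ℕ) {m} → Vec ℕ m → Vec ℕ m
Ψ zero    T = T
Ψ (suc p) T = Data.Vec.map (λ a → a % suc p) T

ZeroSum : ∀ n {m} → Vec ℕ m → Set
ZeroSum n T = sumMod n (Data.Vec.toList T) ≡ 0

ZeroSumFree : ∀ n {m} → Vec ℕ m → Set
ZeroSumFree n {m} S0 =
  (S : Subset m) → ¬ (length (select S S0) ≡ 0) → ¬ (sumMod n (select S S0) ≡ 0)

NZero : ∀ n {m} → Vec ℕ m → ℕ
NZero n {m} S0 = length (filter (λ S → sumMod n (select S S0) ≟ 0) (allSubsets m))

{-# OPTIONS --safe #-}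
module Submission where

-- Adding indices in C_{k;n} and reducing back into the window [k, k + n) preserves residues
-- mod n, so a nonempty sequence sums to the element whose index is congruent to the sum of
-- Ψ(T). Residues mod n are injective on any window of length n, and k ≤ n puts a positive
-- multiple of n in [k, k + n); hence the idempotent is exactly the element of index ≡ 0.
-- A nonempty subsequence is therefore idempotent-sum iff its Ψ-image is zero-sum, and the
-- two counts differ only in the empty subsequence, which is zero-sum but is counted
-- on the semigroup side only when k = 1.

open import Defs
open import Data.Nat using (ℕ; zero; suc; _+_; _*_; _≤_; _<_; _∸_; _≟_; _<?_; s≤s; NonZero; >-nonZero)
open import Data.Nat.Properties
open import Data.Nat.DivMod using (_%_; _/_; m≡m%n+[m/n]*n; m%n%n≡m%n; m%n<n; m<n⇒m%n≡m; %-distribˡ-+; %-remove-+ʳ)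
open import Data.Nat.Divisibility using (_∣_; divides; ∣⇒≤; n∣m⇒m%n≡0; m%n≡0⇒n∣m)
open import Data.Nat.ListAction using (sum)
open import Data.Bool using (true; false)
open import Data.Vec using (Vec; []; _∷_; toList)
import Data.Vec as Vec
open import Data.Vec.Properties using (toList-map)
open import Data.Vec.Relation.Unary.All.Properties using (toList⁺)
open import Data.Vec.Relation.Unary.All using (All; []; _∷_)
open import Data.List using (List; []; _∷_; length; filter; map; _++_)
open import Data.List.Properties using (filter-≐; filter-none; filter-++; length-++; length-map)
import Data.List.Relation.Unary.All as List
open import Data.Maybe using (just)
open import Data.Maybe.Properties using (just-injective)
open import Data.Product using (Σ; _×_; _,_; proj₂)
open import Data.Sum using (_⊎_; inj₁; inj₂; [_,_]′)
open import Data.Fin.Subset using (Subset)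
open import Function using (_∘_; id)
open import Function.Bundles using (_⇔_; mk⇔; Equivalence)
open import Level using (0ℓ)
open import Relation.Binary.PropositionalEquality
open import Relation.Nullary using (¬_; does; yes; no; contradiction)
open import Relation.Nullary.Decidable using (_⊎-dec_; _×-dec_)
open import Relation.Unary using (Pred; Decidable)

open Equivalence

module _ (n : ℕ) .{{_ : NonZero n}} where

  +-cong-% : ∀ {a a′ b b′} → a % n ≡ a′ % n → b % n ≡ b′ % n →
    (a + b) % n ≡ (a′ + b′) % n
  +-cong-% {a} {a′} {b} {b′} a≡a′ b≡b′ = begin
    (a + b) % n             ≡⟨ %-distribˡ-+ a b n ⟩
    (a % n + b % n) % n     ≡⟨ cong₂ (λ x y → (x + y) % n) a≡a′ b≡b′ ⟩
    (a′ % n + b′ % n) % n   ≡⟨ %-distribˡ-+ a′ b′ n ⟨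
    (a′ + b′) % n           ∎
    where open ≡-Reasoning

  +-congˡ-% : ∀ a {b b′} → b % n ≡ b′ % n → (a + b) % n ≡ (a + b′) % n
  +-congˡ-% a = +-cong-% refl

  %-≡⇒∣∸ : ∀ a b → a % n ≡ b % n → n ∣ b ∸ a
  %-≡⇒∣∸ a b a≡b = divides (b / n ∸ a / n) (begin
    b ∸ a                                     ≡⟨ cong₂ _∸_ (m≡m%n+[m/n]*n b n) (m≡m%n+[m/n]*n a n) ⟩
    (b % n + b / n * n) ∸ (a % n + a / n * n) ≡⟨ cong (λ r → (b % n + b / n * n) ∸ (r + a / n * n)) a≡b ⟩
    (b % n + b / n * n) ∸ (b % n + a / n * n) ≡⟨ [m+n]∸[m+o]≡n∸o (b % n) _ _ ⟩
    b / n * n ∸ a / n * n                     ≡⟨ *-distribʳ-∸ n (b / n) (a / n) ⟨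
    (b / n ∸ a / n) * n                       ∎)
    where open ≡-Reasoning

  [m+m]%n≡m%n⇒m%n≡0 : ∀ a → (a + a) % n ≡ a % n → a % n ≡ 0
  [m+m]%n≡m%n⇒m%n≡0 a eq =
    n∣m⇒m%n≡0 a n (subst (n ∣_) (m+n∸m≡n a a) (%-≡⇒∣∸ a (a + a) (sym eq)))

  %-≡-window⇒≤ : ∀ {l a b} → l ≤ a → b < l + n → a % n ≡ b % n → b ≤ a
  %-≡-window⇒≤ {l} {a} {b} l≤a b<l+n a≡b = m∸n≡0⇒m≤n (begin
    b ∸ a         ≡⟨ m<n⇒m%n≡m b∸a<n ⟨
    (b ∸ a) % n   ≡⟨ n∣m⇒m%n≡0 (b ∸ a) n (%-≡⇒∣∸ a b a≡b) ⟩
    0             ∎)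
    where
    open ≡-Reasoning
    b∸a<n : b ∸ a < n
    b∸a<n = ≤-<-trans (∸-monoʳ-≤ b l≤a) (m<n+o⇒m∸n<o b l b<l+n)

  %-injective-on-window : ∀ {l a b} → l ≤ a → a < l + n → l ≤ b → b < l + n →
    a % n ≡ b % n → a ≡ b
  %-injective-on-window l≤a a<l+n l≤b b<l+n a≡b =
    ≤-antisym (%-≡-window⇒≤ l≤b a<l+n (sym a≡b)) (%-≡-window⇒≤ l≤a b<l+n a≡b)

  sum-map-% : ∀ xs → sum (map (_% n) xs) % n ≡ sum xs % n
  sum-map-% []       = refl
  sum-map-% (x ∷ xs) = +-cong-% (m%n%n≡m%n x n) (sum-map-% xs)

module _ {k p : ℕ} where
  private
    n = suc p

  red-% : ∀ t → red k n t % n ≡ t % n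
  red-% t with t <? k + n
  ... | yes _ = refl
  ... | no t≮k+n = trans (+-congˡ-% n k (m%n%n≡m%n (t ∸ k) n))
                         (cong (_% n) (m+[n∸m]≡n (≤-trans (m≤m+n k n) (≮⇒≥ t≮k+n))))

  red-< : ∀ t → red k n t < k + n
  red-< t with t <? k + n
  ... | yes t<k+n = t<k+n
  ... | no _      = +-monoʳ-< k (m%n<n (t ∸ k) n)

  red-≥ : ∀ {l t} → l ≤ k → l ≤ t → l ≤ red k n t
  red-≥ {t = t} l≤k l≤t with t <? k + n
  ... | yes _ = l≤t
  ... | no _  = ≤-trans l≤k (m≤m+n k _)

  σ-∷ : ∀ a as {v} → σ k n as ≡ just v → σ k n (a ∷ as) ≡ just (a ⊕[ k , n ] v)
  σ-∷ a as σ≡v rewrite σ≡v = refl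

  σ-IsElem-% : 1 ≤ k → ∀ a as → List.All (IsElem k n) (a ∷ as) →
    Σ ℕ λ v → σ k n (a ∷ as) ≡ just v × IsElem k n v × v % n ≡ sum (a ∷ as) % n
  σ-IsElem-% 1≤k a [] (a∈C List.∷ _) = a , refl , a∈C , cong (_% n) (sym (+-identityʳ a))
  σ-IsElem-% 1≤k a (b ∷ bs) ((1≤a , _) List.∷ bs∈C) with σ-IsElem-% 1≤k b bs bs∈C
  ... | v , σ≡v , _ , v≡sum =
    red k n (a + v) , σ-∷ a (b ∷ bs) σ≡v ,
    (red-≥ 1≤k (≤-trans 1≤a (m≤m+n a v)) , red-< (a + v)) ,
    trans (red-% (a + v)) (+-congˡ-% n a v≡sum)

  IsIdem⇔%≡0 : k ≤ n → ∀ {v} → IsElem k n v → IsIdem k n v ⇔ v % n ≡ 0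
  IsIdem⇔%≡0 k≤n {v} (1≤v , v<k+n) = mk⇔ to′ from′
    where
    to′ : IsIdem k n v → v % n ≡ 0
    to′ idem = [m+m]%n≡m%n⇒m%n≡0 n v (trans (sym (red-% (v + v))) (cong (_% n) idem))

    from′ : v % n ≡ 0 → IsIdem k n v
    from′ v%n≡0 =
      %-injective-on-window n (red-≥ ≤-refl (≤-trans k≤v (m≤m+n v v))) (red-< (v + v)) k≤v v<k+n
        (trans (red-% (v + v)) (%-remove-+ʳ v n∣v))
      where
      n∣v : n ∣ v
      n∣v = m%n≡0⇒n∣m v n v%n≡0
      k≤v : k ≤ v
      k≤v = ≤-trans k≤n (∣⇒≤ {{>-nonZero 1≤v}} n∣v)

  idemSum⇔sum%≡0 : 1 ≤ k → k ≤ n → ∀ a as → List.All (IsElem k n) (a ∷ as) →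
    IdemSumList k n (a ∷ as) ⇔ sum (a ∷ as) % n ≡ 0
  idemSum⇔sum%≡0 1≤k k≤n a as a∷as∈C with σ-IsElem-% 1≤k a as a∷as∈C
  ... | v , σ≡v , v∈C , v≡sum = mk⇔ to′ from′
    where
    v-idem⇔ : IsIdem k n v ⇔ v % n ≡ 0
    v-idem⇔ = IsIdem⇔%≡0 k≤n v∈C

    to′ : IdemSumList k n (a ∷ as) → sum (a ∷ as) % n ≡ 0
    to′ (e , σ≡e , e-idem) with refl ← just-injective (trans (sym σ≡v) σ≡e) =
      trans (sym v≡sum) (to v-idem⇔ e-idem)

    from′ : sum (a ∷ as) % n ≡ 0 → IdemSumList k n (a ∷ as)
    from′ sum≡0 = v , σ≡v , from v-idem⇔ (trans v≡sum sum≡0)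

  zeroSum-map-%⇔idemSum⊎empty : 1 ≤ k → k ≤ n → ∀ xs → List.All (IsElem k n) xs →
    sumMod n (map (_% n) xs) ≡ 0 ⇔ (IdemSumList k n xs ⊎ length xs ≡ 0)
  zeroSum-map-%⇔idemSum⊎empty 1≤k k≤n [] _ = mk⇔ (λ _ → inj₂ refl) (λ _ → refl)
  zeroSum-map-%⇔idemSum⊎empty 1≤k k≤n (a ∷ as) a∷as∈C = mk⇔
    (λ zero-sum → inj₁ (from idem⇔ (trans (sym (sum-map-% n (a ∷ as))) zero-sum)))
    (λ { (inj₁ idem) → trans (sum-map-% n (a ∷ as)) (to idem⇔ idem) ; (inj₂ ()) })
    where
    idem⇔ : IdemSumList k n (a ∷ as) ⇔ sum (a ∷ as) % n ≡ 0
    idem⇔ = idemSum⇔sum%≡0 1≤k k≤n a as a∷as∈C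

IdemSumList⇒length≢0 : ∀ {k n} xs → IdemSumList k n xs → length xs ≢ 0
IdemSumList⇒length≢0 []      (_ , () , _)
IdemSumList⇒length≢0 (_ ∷ _) _ ()

select-map : ∀ {A B : Set} {m} (f : A → B) (S : Subset m) (T : Vec A m) →
  select S (Vec.map f T) ≡ map f (select S T)
select-map f []          []      = refl
select-map f (true ∷ S)  (a ∷ T) = cong (f a ∷_) (select-map f S T)
select-map f (false ∷ S) (a ∷ T) = select-map f S T

select-All : ∀ {A : Set} {P : Pred A 0ℓ} {m} (S : Subset m) {T : Vec A m} →
  All P T → List.All P (select S T)
select-All []          []        = List.[]
select-All (true ∷ S)  (pa ∷ pT) = pa List.∷ select-All S pT
select-All (false ∷ S) (_ ∷ pT)  = select-All S pT

length-select-Ψ : ∀ p {m} (S : Subset m) (T : Vec ℕ m) →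
  length (select S (Ψ (suc p) T)) ≡ length (select S T)
length-select-Ψ p S T =
  trans (cong length (select-map (_% suc p) S T)) (length-map (_% suc p) (select S T))

count : ∀ {A : Set} {P : Pred A 0ℓ} → Decidable P → List A → ℕ
count P? xs = length (filter P? xs)

count-none : ∀ {A : Set} {P : Pred A 0ℓ} (P? : Decidable P) → (∀ x → ¬ P x) →
  ∀ xs → count P? xs ≡ 0
count-none P? ¬P xs = cong length (filter-none P? (List.universal ¬P xs))

count-++ : ∀ {A : Set} {P : Pred A 0ℓ} (P? : Decidable P) xs ys →
  count P? (xs ++ ys) ≡ count P? xs + count P? ys
count-++ P? xs ys = trans (cong length (filter-++ P? xs ys)) (length-++ (filter P? xs))

count-map : ∀ {A B : Set} {P : Pred B 0ℓ} (P? : Decidable P) (f : A → B) xs →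
  count P? (map f xs) ≡ count (P? ∘ f) xs
count-map P? f []       = refl
count-map P? f (x ∷ xs) with does (P? (f x))
... | true  = cong suc (count-map P? f xs)
... | false = count-map P? f xs

module _ {A : Set} {P Q : Pred A 0ℓ} (P? : Decidable P) (Q? : Decidable Q) where

  count-cong : (∀ x → P x ⇔ Q x) → ∀ xs → count P? xs ≡ count Q? xs
  count-cong P⇔Q = cong length ∘ filter-≐ P? Q? ((λ {x} → to (P⇔Q x)) , (λ {x} → from (P⇔Q x)))

  count-⊎ : (∀ x → P x → ¬ Q x) → ∀ xs →
    count (λ x → P? x ⊎-dec Q? x) xs ≡ count P? xs + count Q? xs
  count-⊎ disjoint []       = refl
  count-⊎ disjoint (x ∷ xs) with P? x | Q? x
  ... | yes px | yes qx = contradiction qx (disjoint x px)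
  ... | yes _  | no _   = cong suc (count-⊎ disjoint xs)
  ... | no _   | yes _  = trans (cong suc (count-⊎ disjoint xs)) (sym (+-suc _ _))
  ... | no _   | no _   = count-⊎ disjoint xs

count-emptySelections : ∀ {A : Set} {m} (T : Vec A m) →
  count (λ S → length (select S T) ≟ 0) (allSubsets m) ≡ 1
count-emptySelections {m = zero}  []      = refl
count-emptySelections {m = suc m} (a ∷ T) = begin
  count empty? (map (true ∷_) subsets ++ map (false ∷_) subsets)
    ≡⟨ count-++ empty? (map (true ∷_) subsets) _ ⟩
  count empty? (map (true ∷_) subsets) + count empty? (map (false ∷_) subsets)
    ≡⟨ cong₂ _+_ (trans (count-map empty? (true ∷_) subsets) (count-none _ (λ _ ()) subsets))
                 (count-map empty? (false ∷_) subsets) ⟩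
  count (λ S → length (select S T) ≟ 0) subsets
    ≡⟨ count-emptySelections T ⟩
  1 ∎
  where
  open ≡-Reasoning
  subsets : List (Subset m)
  subsets = allSubsets m

  empty? : Decidable (λ (S : Subset (suc m)) → length (select S (a ∷ T)) ≡ 0)
  empty? S = length (select S (a ∷ T)) ≟ 0

NIdem⁺ : ∀ k n {m} → Vec ℕ m → ℕ
NIdem⁺ k n {m} T = count (λ S → idemSumList? k n (select S T)) (allSubsets m)

module _ {k n m : ℕ} (T : Vec ℕ m) where

  NIdem≡NIdem⁺+countEmpty :
    NIdem k n T ≡ NIdem⁺ k n T + count (λ S → (k ≟ 1) ×-dec (length (select S T) ≟ 0)) (allSubsets m)
  NIdem≡NIdem⁺+countEmpty =
    count-⊎ _ _ (λ S idem (_ , empty) → IdemSumList⇒length≢0 (select S T) idem empty) (allSubsets m)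

  NIdem≡NIdem⁺ : 1 < k → NIdem k n T ≡ NIdem⁺ k n T
  NIdem≡NIdem⁺ 1<k = trans NIdem≡NIdem⁺+countEmpty
    (trans (cong (NIdem⁺ k n T +_) (count-none _ (λ _ (k≡1 , _) → <⇒≢ 1<k (sym k≡1)) (allSubsets m)))
           (+-identityʳ _))

  NIdem≡NIdem⁺+1 : k ≡ 1 → NIdem k n T ≡ NIdem⁺ k n T + 1
  NIdem≡NIdem⁺+1 k≡1 = trans NIdem≡NIdem⁺+countEmpty (cong (NIdem⁺ k n T +_)
    (trans (count-cong _ _ (λ _ → mk⇔ proj₂ (k≡1 ,_)) (allSubsets m)) (count-emptySelections T)))

module _ {k p : ℕ} (1≤k : 1 ≤ k) (k≤n : k ≤ suc p) where
  private
    n = suc p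

  Ψ-zeroSum⇔idemSum⊎empty : ∀ {m} {T : Vec ℕ m} → All (IsElem k n) T → ∀ S →
    sumMod n (select S (Ψ n T)) ≡ 0 ⇔ (IdemSumList k n (select S T) ⊎ length (select S T) ≡ 0)
  Ψ-zeroSum⇔idemSum⊎empty {T = T} T∈C S =
    subst (λ ys → sumMod n ys ≡ 0 ⇔ (IdemSumList k n (select S T) ⊎ length (select S T) ≡ 0))
          (sym (select-map (_% n) S T))
          (zeroSum-map-%⇔idemSum⊎empty 1≤k k≤n (select S T) (select-All S T∈C))

  idemSumFree⇔zeroSumFree : ∀ {m} {T : Vec ℕ m} → All (IsElem k n) T →
    IdemSumFree k n T ⇔ ZeroSumFree n (Ψ n T)
  idemSumFree⇔zeroSumFree {T = T} T∈C = mk⇔ to′ from′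
    where
    to′ : IdemSumFree k n T → ZeroSumFree n (Ψ n T)
    to′ free S nonempty zero-sum with to (Ψ-zeroSum⇔idemSum⊎empty T∈C S) zero-sum
    ... | inj₁ idem  = free S idem
    ... | inj₂ empty = nonempty (trans (length-select-Ψ p S T) empty)

    from′ : ZeroSumFree n (Ψ n T) → IdemSumFree k n T
    from′ free S idem = free S
      (IdemSumList⇒length≢0 (select S T) idem ∘ trans (sym (length-select-Ψ p S T)))
      (from (Ψ-zeroSum⇔idemSum⊎empty T∈C S) (inj₁ idem))

  idemSum⇔zeroSum : ∀ {m} {T : Vec ℕ (suc m)} → All (IsElem k n) T →
    IdemSum k n T ⇔ ZeroSum n (Ψ n T)
  idemSum⇔zeroSum {T = a ∷ T} T∈C =
    subst (λ ys → IdemSum k n (a ∷ T) ⇔ sumMod n ys ≡ 0) (sym (toList-map (_% n) (a ∷ T)))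
      (mk⇔ (from zeroSum⇔ ∘ inj₁) ([ id , (λ ()) ]′ ∘ to zeroSum⇔))
    where
    zeroSum⇔ : sumMod n (map (_% n) (toList (a ∷ T))) ≡ 0 ⇔
               (IdemSum k n (a ∷ T) ⊎ length (toList (a ∷ T)) ≡ 0)
    zeroSum⇔ = zeroSum-map-%⇔idemSum⊎empty 1≤k k≤n (toList (a ∷ T)) (toList⁺ T∈C)

  NZero-Ψ≡NIdem⁺+1 : ∀ {m} {T : Vec ℕ m} → All (IsElem k n) T →
    NZero n (Ψ n T) ≡ NIdem⁺ k n T + 1
  NZero-Ψ≡NIdem⁺+1 {m} {T} T∈C = begin
    NZero n (Ψ n T)
      ≡⟨ count-cong _ _ (Ψ-zeroSum⇔idemSum⊎empty T∈C) (allSubsets m) ⟩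
    count (λ S → idemSumList? k n (select S T) ⊎-dec (length (select S T) ≟ 0)) (allSubsets m)
      ≡⟨ count-⊎ _ _ (λ S → IdemSumList⇒length≢0 (select S T)) (allSubsets m) ⟩
    NIdem⁺ k n T + count (λ S → length (select S T) ≟ 0) (allSubsets m)
      ≡⟨ cong (NIdem⁺ k n T +_) (count-emptySelections T) ⟩
    NIdem⁺ k n T + 1 ∎
    where open ≡-Reasoning

mainTheorem9 : (k n m : ℕ) → 1 ≤ k → k ≤ n →
    (T : Vec ℕ (suc m)) → All (IsElem k n) T →
    (IdemSumFree k n T ⇔ ZeroSumFree n (Ψ n T)) ×
    (IdemSum k n T ⇔ ZeroSum n (Ψ n T)) ×
    (1 < k → NIdem k n T ≡ NZero n (Ψ n T) ∸ 1) ×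
    (k ≡ 1 → NIdem k n T ≡ NZero n (Ψ n T))
mainTheorem9 _ zero    _ (s≤s _) () _ _
mainTheorem9 k (suc p) m 1≤k k≤n T T∈C =
  idemSumFree⇔zeroSumFree 1≤k k≤n T∈C ,
  idemSum⇔zeroSum 1≤k k≤n T∈C ,
  (λ 1<k → trans (NIdem≡NIdem⁺ T 1<k) (sym (trans (cong (_∸ 1) NZero≡) (m+n∸n≡m _ 1)))) ,
  (λ k≡1 → trans (NIdem≡NIdem⁺+1 T k≡1) (sym NZero≡))
  where
  NZero≡ : NZero (suc p) (Ψ (suc p) T) ≡ NIdem⁺ k (suc p) T + 1
  NZero≡ = NZero-Ψ≡NIdem⁺+1 1≤k k≤n T∈C
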